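{- Let $k$ and $n$ be positive integers. If $D$ is a finite digraph on at most $n$ vertices with minimum out-degree $\delta^{+}(D) > (k-1) \lceil \log n\rceil$, then there exists a sub-digraph $D' \subseteq D$ such that (1) for all $v \in V(D')$ we have $d_{D'}^{+}(v) \geq d_{D}^{+}(v) - (k-1) \lceil \log n\rceil$, and (2) $\kappa(U(D')) \geq k$.
   Context: Digraphs may contain bidirectional edges (both $\overrightarrow{xy}$ and $\overrightarrow{yx}$). For a digraph $D$ and $v\in V(D)$, $d^+_D(v)$ is the out-degree of $v$ in $D$ and $\delta^+(D)$ the minimum out-degree. $U(D)$ is the underlying graph of $D$, obtained by ignoring edge directions and merging multiple edges. $\kappa$ denotes vertex-connectivity: a graph is $k$-connected if one must remove at least $k$ vertices in order to disconnect it or to leave only a single vertex, and $\kappa$ is the largest such $k$. Here $\log$ denotes the logarithm to base $2$. -}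

module Defs where

open import Data.Nat using (ℕ; zero; suc; _+_; _*_; _∸_; _≤_; _<_)
open import Data.Nat.Logarithm using (⌈log₂_⌉) public
open import Data.Fin using (Fin; zero; suc)
open import Data.Bool using (Bool; true; false; _∧_; not; if_then_else_)
open import Data.Sum using (_⊎_)
open import Data.Product using (_×_)
open import Relation.Binary.PropositionalEquality using (_≡_)

countTrue : ∀ {m} → (Fin m → Bool) → ℕ
countTrue {zero} P = 0
countTrue {suc m} P = (if P zero then 1 else 0) + countTrue (λ i → P (suc i))

-- A finite digraph on vertex set Fin m: no loops, no multiple arcs;
-- both arcs xy and yx may be present.
record Digraph (m : ℕ) : Set where
  field
    arc    : Fin m → Fin m → Bool
    irrefl : ∀ v → arc v v ≡ false
open Digraph public

outdeg : ∀ {m} → Digraph m → Fin m → ℕ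
outdeg D v = countTrue (arc D v)

record SubDigraph {m : ℕ} (D : Digraph m) : Set where
  field
    vert    : Fin m → Bool
    arc'    : Fin m → Fin m → Bool
    arc'⊆   : ∀ u w → arc' u w ≡ true → arc D u w ≡ true
    arc'-vs : ∀ u w → arc' u w ≡ true → (vert u ≡ true × vert w ≡ true)
open SubDigraph public

outdeg' : ∀ {m} {D : Digraph m} → SubDigraph D → Fin m → ℕ
outdeg' D' v = countTrue (arc' D' v)

-- Reachability in the underlying undirected graph U(D'), using only
-- vertices from the set R (R is a vertex set of D' minus removed vertices).
data Reach {m : ℕ} {D : Digraph m} (D' : SubDigraph D) (R : Fin m → Bool)
           (u : Fin m) : Fin m → Set where
  here : Reach D' R u u
  step : ∀ {v w} → Reach D' R u v → R w ≡ true →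
         (arc' D' v w ≡ true ⊎ arc' D' w v ≡ true) → Reach D' R u w

remove : ∀ {m} {D : Digraph m} → SubDigraph D → (Fin m → Bool) → Fin m → Bool
remove D' X v = vert D' v ∧ not (X v)

-- κ(U(D')) ≥ k : removing any set X of fewer than k vertices of D' leaves
-- a connected graph with at least two vertices.
KConnected : ∀ {m} {D : Digraph m} → ℕ → SubDigraph D → Set
KConnected {m} k D' =
  (X : Fin m → Bool) →
  (∀ v → X v ≡ true → vert D' v ≡ true) →
  countTrue X < k →
  (2 ≤ countTrue (remove D' X)) ×
  (∀ u w → remove D' X u ≡ true → remove D' X w ≡ true → Reach D' (remove D' X) u w)

-- Induction on L, for vertex sets W with ⌈log₂ ∣W∣⌉ ≤ L on which every out-degree inside W
-- exceeds c·L, where k = c + 1.  If D[W] is not k-connected, some X with ∣X∣ ≤ c separates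
-- it.  X cannot leave fewer than two vertices, for then every out-degree would be at most c;
-- so W ∖ X falls into two parts with no edge between them.  The smaller part C has
-- ∣C∣ ≤ ∣W∣/2, hence ⌈log₂ ∣C∣⌉ ≤ L − 1, and every out-arc from C inside W ends in C ∪ X,
-- so each vertex of C loses at most c out-neighbours.  Constructively, k-connectivity of
-- D[W] is decided by trying every X, computing components by saturation.
module Submission where

open import Defs
open import Data.Nat using (ℕ; zero; suc; _+_; _*_; _∸_; _≤_; _<_; z≤n; s≤s; ⌊_/2⌋; ⌈_/2⌉; _≤?_)
open import Data.Nat.Properties
open import Data.Nat.Logarithm using (⌈log₂⌉-mono-≤; ⌈log₂⌈n/2⌉⌉≡⌈log₂n⌉∸1)
open import Algebra.Properties.CommutativeSemigroup +-commutativeSemigroup using (interchange)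
open import Data.Fin using (Fin; zero; suc)
import Data.Fin.Properties as Fin
open import Data.Fin.Properties using (any?)
open import Data.Bool using (Bool; true; false; _∧_; _∨_; not; if_then_else_)
import Data.Bool.Properties as Bool
open import Data.Bool.Properties using (∧-conicalˡ; ∧-conicalʳ; ∧-zeroʳ; ∨-zeroʳ; not-injective)
open import Data.Vec.Functional using (_∷_; head; tail)
open import Data.Vec.Functional.Properties using (∷-cong)
open import Data.Product using (Σ; ∃; _×_; _,_; proj₁; proj₂)
open import Data.Sum using (_⊎_; inj₁; inj₂; swap)
open import Relation.Nullary using (Dec; yes; no; does; ¬_; contradiction)
open import Relation.Nullary.Decidable using (_×-dec_; _⊎-dec_)
open import Relation.Binary.PropositionalEquality
  using (_≡_; _≢_; _≗_; refl; sym; trans; cong; cong₂; subst; module ≡-Reasoning)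

Subset : ℕ → Set
Subset m = Fin m → Bool

private
  variable
    m k L : ℕ
    i u v w : Fin m
    P Q R S W X : Subset m

infix  4 _∈_ _∉_ _⊆_
infixr 7 _∩_
infixr 6 _∪_ _─_

_∈_ _∉_ : Fin m → Subset m → Set
i ∈ P = P i ≡ true
i ∉ P = P i ≡ false

_⊆_ : Subset m → Subset m → Set
P ⊆ Q = ∀ i → i ∈ P → i ∈ Q

∅ ⊤ : Subset m
∅ _ = false
⊤ _ = true

_∩_ _∪_ _─_ : Subset m → Subset m → Subset m
(P ∩ Q) i = P i ∧ Q i
(P ∪ Q) i = P i ∨ Q i
(P ─ Q) i = P i ∧ not (Q i)  -- so remove D' X unfolds to vert D' ─ X

⁅_⁆ : Fin m → Subset m
⁅ u ⁆ i = does (u Fin.≟ i)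

∣_∣ : Subset m → ℕ
∣_∣ = countTrue

false≢true : false ≢ true
false≢true ()

∉⇒¬∈ : ∀ P → i ∉ P → ¬ i ∈ P
∉⇒¬∈ P i∉P i∈P = false≢true (trans (sym i∉P) i∈P)

∈⊎∉ : (P : Subset m) (i : Fin m) → i ∈ P ⊎ i ∉ P
∈⊎∉ P i with P i
... | true  = inj₁ refl
... | false = inj₂ refl

x∈p∩q⁺ : ∀ P Q → i ∈ P → i ∈ Q → i ∈ P ∩ Q
x∈p∩q⁺ P Q i∈P i∈Q rewrite i∈P | i∈Q = refl

x∈p∩q⁻ : ∀ P Q → i ∈ P ∩ Q → i ∈ P × i ∈ Q
x∈p∩q⁻ {i = i} P Q e = ∧-conicalˡ (P i) (Q i) e , ∧-conicalʳ (P i) (Q i) e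

x∈p∪q⁺ : ∀ P Q → i ∈ P ⊎ i ∈ Q → i ∈ P ∪ Q
x∈p∪q⁺ P Q (inj₁ i∈P) rewrite i∈P = refl
x∈p∪q⁺ {i = i} P Q (inj₂ i∈Q) rewrite i∈Q = ∨-zeroʳ (P i)

x∈p∪q⁻ : ∀ P Q → i ∈ P ∪ Q → i ∈ P ⊎ i ∈ Q
x∈p∪q⁻ {i = i} P Q e with P i
... | true  = inj₁ refl
... | false = inj₂ e

x∈p─q⁺ : ∀ P Q → i ∈ P → i ∉ Q → i ∈ P ─ Q
x∈p─q⁺ P Q i∈P i∉Q rewrite i∈P | i∉Q = refl

x∈p─q⁻ : ∀ P Q → i ∈ P ─ Q → i ∈ P × i ∉ Q
x∈p─q⁻ {i = i} P Q e =
  ∧-conicalˡ (P i) _ e , not-injective (∧-conicalʳ (P i) (not (Q i)) e)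

x∈⁅x⁆ : (u : Fin m) → u ∈ ⁅ u ⁆
x∈⁅x⁆ u with u Fin.≟ u
... | yes _  = refl
... | no u≢u = contradiction refl u≢u

x∈⁅y⁆⇒x≡y : (u : Fin m) → i ∈ ⁅ u ⁆ → i ≡ u
x∈⁅y⁆⇒x≡y {i = i} u e with u Fin.≟ i
... | yes u≡i = sym u≡i
... | no _    = contradiction e false≢true

-- Cardinality

bit : Bool → ℕ
bit b = if b then 1 else 0

bit-mono : ∀ {a b} → (a ≡ true → b ≡ true) → bit a ≤ bit b
bit-mono {false} _ = z≤n
bit-mono {true}  h rewrite h refl = ≤-refl

bit-∨+∧ : ∀ a b → bit (a ∨ b) + bit (a ∧ b) ≡ bit a + bit b
bit-∨+∧ false b     = +-identityʳ (bit b)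
bit-∨+∧ true  false = refl
bit-∨+∧ true  true  = refl

∣p∣≤m : (P : Subset m) → ∣ P ∣ ≤ m
∣p∣≤m {zero}  P = z≤n
∣p∣≤m {suc m} P with P zero
... | true  = s≤s (∣p∣≤m (tail P))
... | false = m≤n⇒m≤1+n (∣p∣≤m (tail P))

∣∅∣≡0 : ∣ ∅ {m} ∣ ≡ 0
∣∅∣≡0 {zero}  = refl
∣∅∣≡0 {suc m} = ∣∅∣≡0 {m}

∣⊤∣≡m : ∣ ⊤ {m} ∣ ≡ m
∣⊤∣≡m {zero}  = refl
∣⊤∣≡m {suc m} = cong suc (∣⊤∣≡m {m})

∣∣-cong : P ≗ Q → ∣ P ∣ ≡ ∣ Q ∣
∣∣-cong {zero}  P≗Q = refl
∣∣-cong {suc m} P≗Q = cong₂ _+_ (cong bit (P≗Q zero)) (∣∣-cong (λ i → P≗Q (suc i)))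

p⊆q⇒∣p∣≤∣q∣ : P ⊆ Q → ∣ P ∣ ≤ ∣ Q ∣
p⊆q⇒∣p∣≤∣q∣ {zero}  P⊆Q = z≤n
p⊆q⇒∣p∣≤∣q∣ {suc m} P⊆Q =
  +-mono-≤ (bit-mono (P⊆Q zero)) (p⊆q⇒∣p∣≤∣q∣ (λ i → P⊆Q (suc i)))

p⊊q⇒∣p∣<∣q∣ : P ⊆ Q → i ∈ Q → i ∉ P → ∣ P ∣ < ∣ Q ∣
p⊊q⇒∣p∣<∣q∣ {suc m} {i = zero} P⊆Q i∈Q i∉P rewrite i∈Q | i∉P =
  s≤s (p⊆q⇒∣p∣≤∣q∣ (λ j → P⊆Q (suc j)))
p⊊q⇒∣p∣<∣q∣ {suc m} {i = suc i} P⊆Q i∈Q i∉P =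
  +-mono-≤-< (bit-mono (P⊆Q zero)) (p⊊q⇒∣p∣<∣q∣ (λ j → P⊆Q (suc j)) i∈Q i∉P)

x∈p⇒0<∣p∣ : ∀ P → i ∈ P → 0 < ∣ P ∣
x∈p⇒0<∣p∣ {m} P i∈P =
  subst (_< ∣ P ∣) (∣∅∣≡0 {m}) (p⊊q⇒∣p∣<∣q∣ {P = ∅} {Q = P} (λ _ ()) i∈P refl)

0<∣p∣⇒∃∈ : 0 < ∣ P ∣ → ∃ (_∈ P)
0<∣p∣⇒∃∈ {suc m} {P} pos with P zero in P₀
... | true  = zero , P₀
... | false = let j , j∈P = 0<∣p∣⇒∃∈ pos in suc j , j∈P

∣p∪q∣+∣p∩q∣≡∣p∣+∣q∣ : (P Q : Subset m) → ∣ P ∪ Q ∣ + ∣ P ∩ Q ∣ ≡ ∣ P ∣ + ∣ Q ∣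
∣p∪q∣+∣p∩q∣≡∣p∣+∣q∣ {zero}  P Q = refl
∣p∪q∣+∣p∩q∣≡∣p∣+∣q∣ {suc m} P Q = begin
  (bit (a ∨ b) + ∣ tail P ∪ tail Q ∣) + (bit (a ∧ b) + ∣ tail P ∩ tail Q ∣)
    ≡⟨ interchange (bit (a ∨ b)) _ _ _ ⟩
  (bit (a ∨ b) + bit (a ∧ b)) + (∣ tail P ∪ tail Q ∣ + ∣ tail P ∩ tail Q ∣)
    ≡⟨ cong₂ _+_ (bit-∨+∧ a b) (∣p∪q∣+∣p∩q∣≡∣p∣+∣q∣ (tail P) (tail Q)) ⟩
  (bit a + bit b) + (∣ tail P ∣ + ∣ tail Q ∣)
    ≡⟨ interchange (bit a) _ _ _ ⟩
  (bit a + ∣ tail P ∣) + (bit b + ∣ tail Q ∣) ∎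
  where
  open ≡-Reasoning
  a = P zero
  b = Q zero

p⊆q∪r⇒∣p∣≤∣q∣+∣r∣ : P ⊆ Q ∪ R → ∣ P ∣ ≤ ∣ Q ∣ + ∣ R ∣
p⊆q∪r⇒∣p∣≤∣q∣+∣r∣ {P = P} {Q = Q} {R = R} P⊆Q∪R = begin
  ∣ P ∣                     ≤⟨ p⊆q⇒∣p∣≤∣q∣ P⊆Q∪R ⟩
  ∣ Q ∪ R ∣                 ≤⟨ m≤m+n _ _ ⟩
  ∣ Q ∪ R ∣ + ∣ Q ∩ R ∣     ≡⟨ ∣p∪q∣+∣p∩q∣≡∣p∣+∣q∣ Q R ⟩
  ∣ Q ∣ + ∣ R ∣             ∎
  where open ≤-Reasoning

disjoint⇒∣p∣+∣q∣≤∣r∣ : {P Q R : Subset m} → (∀ i → i ∈ P → ¬ i ∈ Q) →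
                       P ⊆ R → Q ⊆ R → ∣ P ∣ + ∣ Q ∣ ≤ ∣ R ∣
disjoint⇒∣p∣+∣q∣≤∣r∣ {m} {P} {Q} {R} disjoint P⊆R Q⊆R = begin
  ∣ P ∣ + ∣ Q ∣             ≡⟨ ∣p∪q∣+∣p∩q∣≡∣p∣+∣q∣ P Q ⟨
  ∣ P ∪ Q ∣ + ∣ P ∩ Q ∣     ≡⟨ cong (∣ P ∪ Q ∣ +_) ∣P∩Q∣≡0 ⟩
  ∣ P ∪ Q ∣ + 0             ≡⟨ +-identityʳ _ ⟩
  ∣ P ∪ Q ∣                 ≤⟨ p⊆q⇒∣p∣≤∣q∣ P∪Q⊆R ⟩
  ∣ R ∣                     ∎
  where
  open ≤-Reasoning
  P∪Q⊆R : P ∪ Q ⊆ R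
  P∪Q⊆R i e with x∈p∪q⁻ P Q e
  ... | inj₁ i∈P = P⊆R i i∈P
  ... | inj₂ i∈Q = Q⊆R i i∈Q
  P∩Q⊆∅ : P ∩ Q ⊆ ∅
  P∩Q⊆∅ i e = let i∈P , i∈Q = x∈p∩q⁻ P Q e in contradiction i∈Q (disjoint i i∈P)
  ∣P∩Q∣≡0 : ∣ P ∩ Q ∣ ≡ 0
  ∣P∩Q∣≡0 = n≤0⇒n≡0 (subst (∣ P ∩ Q ∣ ≤_) (∣∅∣≡0 {m}) (p⊆q⇒∣p∣≤∣q∣ P∩Q⊆∅))

⌈log₂n⌉≤0⇒n≤1 : ∀ {n} → ⌈log₂ n ⌉ ≤ 0 → n ≤ 1
⌈log₂n⌉≤0⇒n≤1 {n} log≤0 with n ≤? 1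
... | yes n≤1 = n≤1
... | no  n≰1 = contradiction (≤-trans (⌈log₂⌉-mono-≤ (≰⇒> n≰1)) log≤0) λ ()

⌈log₂⌉-half : ∀ {a b} → a + a ≤ b → ⌈log₂ b ⌉ ≤ suc L → ⌈log₂ a ⌉ ≤ L
⌈log₂⌉-half {L} {a} {b} a+a≤b log≤ = begin
  ⌈log₂ a ⌉            ≤⟨ ⌈log₂⌉-mono-≤ a≤⌈b/2⌉ ⟩
  ⌈log₂ ⌈ b /2⌉ ⌉      ≡⟨ ⌈log₂⌈n/2⌉⌉≡⌈log₂n⌉∸1 b ⟩
  ⌈log₂ b ⌉ ∸ 1        ≤⟨ ∸-monoˡ-≤ 1 log≤ ⟩
  L                    ∎
  where
  open ≤-Reasoning
  a≤⌈b/2⌉ : a ≤ ⌈ b /2⌉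
  a≤⌈b/2⌉ = begin
    a              ≡⟨ n≡⌊n+n/2⌋ a ⟩
    ⌊ a + a /2⌋    ≤⟨ ⌊n/2⌋-mono a+a≤b ⟩
    ⌊ b /2⌋        ≤⟨ ⌊n/2⌋≤⌈n/2⌉ b ⟩
    ⌈ b /2⌉        ∎

-- Reachability and components

Adjacent : {D : Digraph m} → SubDigraph D → Fin m → Fin m → Set
Adjacent D' v w = arc' D' v w ≡ true ⊎ arc' D' w v ≡ true

module _ {D : Digraph m} {D' : SubDigraph D} where

  Reach-trans : Reach D' R u v → Reach D' R v w → Reach D' R u w
  Reach-trans u⇝v here              = u⇝v
  Reach-trans u⇝v (step v⇝w x∈R adj) = step (Reach-trans u⇝v v⇝w) x∈R adj

  Reach-∈ : u ∈ R → Reach D' R u v → v ∈ R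
  Reach-∈ u∈R here             = u∈R
  Reach-∈ _   (step _ v∈R _)    = v∈R

  Reach-sym : u ∈ R → Reach D' R u v → Reach D' R v u
  Reach-sym u∈R here = here
  Reach-sym u∈R (step u⇝x w∈R adj) =
    Reach-trans (step here (Reach-∈ u∈R u⇝x) (swap adj)) (Reach-sym u∈R u⇝x)

  Reach-cong : R ≗ S → Reach D' R u v → Reach D' S u v
  Reach-cong R≗S here               = here
  Reach-cong R≗S (step u⇝x w∈R adj) = step (Reach-cong R≗S u⇝x) (trans (sym (R≗S _)) w∈R) adj

module _ {D : Digraph m} (D' : SubDigraph D) (R : Subset m) where

  Closed : Subset m → Set
  Closed A = ∀ x y → x ∈ A → y ∈ R → Adjacent D' x y → y ∈ A

  Closed-─ : ∀ {A} → Closed A → Closed (R ─ A)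
  Closed-─ {A} closed x y x∈R─A y∈R adj with ∈⊎∉ A y
  ... | inj₂ y∉A = x∈p─q⁺ R A y∈R y∉A
  ... | inj₁ y∈A = contradiction (closed y x y∈A x∈R (swap adj)) (∉⇒¬∈ A x∉A)
    where
    x∈R : x ∈ R
    x∈R = proj₁ (x∈p─q⁻ R A x∈R─A)
    x∉A : x ∉ A
    x∉A = proj₂ (x∈p─q⁻ R A x∈R─A)

  record Disconnection : Set where
    field
      A      : Subset m
      a      : Fin m
      a∈A    : a ∈ A
      A⊆R    : A ⊆ R
      b      : Fin m
      b∈R─A  : b ∈ R ─ A
      closed : Closed A

  private
    ReachableFrom : Fin m → Subset m → Set
    ReachableFrom u S = ∀ y → y ∈ S → Reach D' R u y

    Component : Fin m → Set
    Component u = Σ (Subset m) λ A → u ∈ A × ReachableFrom u A × Closed A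

    Frontier : Subset m → Fin m → Set
    Frontier S y = y ∈ R × y ∉ S × ∃ λ x → x ∈ S × Adjacent D' x y

    frontier? : (S : Subset m) → Dec (∃ (Frontier S))
    frontier? S = any? λ y →
      (R y Bool.≟ true) ×-dec (S y Bool.≟ false) ×-dec
      any? (λ x → (S x Bool.≟ true) ×-dec
                  ((arc' D' x y Bool.≟ true) ⊎-dec (arc' D' y x Bool.≟ true)))

    no-frontier⇒Closed : ¬ ∃ (Frontier S) → Closed S
    no-frontier⇒Closed {S} ¬frontier x y x∈S y∈R adj with ∈⊎∉ S y
    ... | inj₁ y∈S = y∈S
    ... | inj₂ y∉S = contradiction (y , y∈R , y∉S , x , x∈S , adj) ¬frontier

    -- Each round adds a vertex to S, which keeps the invariant m < ∣ S ∣ + fuel.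
    saturate : ∀ {u} fuel S → m < ∣ S ∣ + fuel → ReachableFrom u S →
               Σ (Subset m) λ A → S ⊆ A × ReachableFrom u A × Closed A
    saturate zero S m<∣S∣ _ =
      contradiction (∣p∣≤m S) (<⇒≱ (subst (m <_) (+-identityʳ _) m<∣S∣))
    saturate {u} (suc fuel) S m<∣S∣+fuel+1 u⇝S with frontier? S
    ... | no ¬frontier = S , (λ _ y∈S → y∈S) , u⇝S , no-frontier⇒Closed ¬frontier
    ... | yes (y , y∈R , y∉S , x , x∈S , adj) =
      let A , S′⊆A , u⇝A , closed = saturate fuel S′ m<∣S′∣+fuel u⇝S′
      in A , (λ z z∈S → S′⊆A z (S⊆S′ z z∈S)) , u⇝A , closed
      where
      S′ : Subset m
      S′ = S ∪ ⁅ y ⁆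
      S⊆S′ : S ⊆ S′
      S⊆S′ _ z∈S = x∈p∪q⁺ S ⁅ y ⁆ (inj₁ z∈S)
      y∈S′ : y ∈ S′
      y∈S′ = x∈p∪q⁺ S ⁅ y ⁆ (inj₂ (x∈⁅x⁆ y))
      m<∣S′∣+fuel : m < ∣ S′ ∣ + fuel
      m<∣S′∣+fuel = ≤-trans (subst (m <_) (+-suc _ fuel) m<∣S∣+fuel+1)
                            (+-monoˡ-≤ fuel (p⊊q⇒∣p∣<∣q∣ S⊆S′ y∈S′ y∉S))
      u⇝S′ : ReachableFrom u S′
      u⇝S′ z z∈S′ with x∈p∪q⁻ S ⁅ y ⁆ z∈S′
      ... | inj₁ z∈S = u⇝S z z∈S
      ... | inj₂ z∈⁅y⁆ with x∈⁅y⁆⇒x≡y y z∈⁅y⁆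
      ...   | refl = step (u⇝S x x∈S) y∈R adj

    component : (u : Fin m) → Component u
    component u =
      let A , ⁅u⁆⊆A , u⇝A , closed = saturate m ⁅ u ⁆ m<∣⁅u⁆∣+m u⇝⁅u⁆
      in A , ⁅u⁆⊆A u (x∈⁅x⁆ u) , u⇝A , closed
      where
      m<∣⁅u⁆∣+m : m < ∣ ⁅ u ⁆ ∣ + m
      m<∣⁅u⁆∣+m = +-monoˡ-≤ m (x∈p⇒0<∣p∣ ⁅ u ⁆ (x∈⁅x⁆ u))
      u⇝⁅u⁆ : ReachableFrom u ⁅ u ⁆
      u⇝⁅u⁆ y y∈⁅u⁆ with x∈⁅y⁆⇒x≡y u y∈⁅u⁆
      ... | refl = here

  connected⊎disconnected : u ∈ R →
    (∀ v w → v ∈ R → w ∈ R → Reach D' R v w) ⊎ Disconnection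
  connected⊎disconnected {u} u∈R = split (component u)
    where
    split : Component u →
            (∀ v w → v ∈ R → w ∈ R → Reach D' R v w) ⊎ Disconnection
    split (A , u∈A , u⇝A , closed) with any? (λ w → (R w Bool.≟ true) ×-dec (A w Bool.≟ false))
    ... | yes (b , b∈R , b∉A) = inj₂ record
      { A = A ; a = u ; a∈A = u∈A ; A⊆R = λ y y∈A → Reach-∈ u∈R (u⇝A y y∈A)
      ; b = b ; b∈R─A = x∈p─q⁺ R A b∈R b∉A ; closed = closed }
    ... | no ¬outside = inj₁ λ v w v∈R w∈R →
      Reach-trans (Reach-sym u∈R (u⇝A v (inside v∈R))) (u⇝A w (inside w∈R))
      where
      inside : ∀ {y} → y ∈ R → y ∈ A
      inside {y} y∈R with ∈⊎∉ A y
      ... | inj₁ y∈A = y∈A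
      ... | inj₂ y∉A = contradiction (y , y∈R , y∉A) ¬outside

-- Exhaustive search over subsets

all⊎counterexample : {P Q : Subset m → Set} → (∀ {S S′} → S ≗ S′ → P S → P S′) →
                     (∀ S → P S ⊎ Q S) → (∀ S → P S) ⊎ ∃ Q
all⊎counterexample {zero} resp P⊎Q with P⊎Q (λ ())
... | inj₁ p = inj₁ λ _ → resp (λ ()) p
... | inj₂ q = inj₂ (_ , q)
all⊎counterexample {suc m} {P} {Q} resp P⊎Q = combine (search true) (search false)
  where
  search : (b : Bool) → (∀ S → P (b ∷ S)) ⊎ ∃ (λ S → Q (b ∷ S))
  search b = all⊎counterexample (λ S≗S′ → resp (∷-cong refl S≗S′)) (λ S → P⊎Q (b ∷ S))

  combine : (∀ S → P (true ∷ S)) ⊎ ∃ (λ S → Q (true ∷ S)) →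
            (∀ S → P (false ∷ S)) ⊎ ∃ (λ S → Q (false ∷ S)) →
            (∀ S → P S) ⊎ ∃ Q
  combine (inj₂ (S , q)) _              = inj₂ (true ∷ S , q)
  combine (inj₁ _)       (inj₂ (S , q)) = inj₂ (false ∷ S , q)
  combine (inj₁ Pt)      (inj₁ Pf)      =
    inj₁ λ S → resp (∷-cong refl λ _ → refl) (P-cons (head S) (tail S))
    where
    P-cons : ∀ b S → P (b ∷ S)
    P-cons true  = Pt
    P-cons false = Pf

-- KConnected k D' unfolds to ∀ X → KConnectedAt k D' X.
KConnectedAt : {D : Digraph m} → ℕ → SubDigraph D → Subset m → Set
KConnectedAt k D' X =
  X ⊆ vert D' → ∣ X ∣ < k →
  (2 ≤ ∣ remove D' X ∣) × (∀ u w → u ∈ remove D' X → w ∈ remove D' X → Reach D' (remove D' X) u w)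

KConnectedAt-cong : {D : Digraph m} {D' : SubDigraph D} →
                    X ≗ S → KConnectedAt k D' X → KConnectedAt k D' S
KConnectedAt-cong {X = X} {S = S} {k = k} {D' = D'} X≗S κ S⊆V ∣S∣<k
  with κ (λ i i∈X → S⊆V i (trans (sym (X≗S i)) i∈X)) (subst (_< k) (sym (∣∣-cong X≗S)) ∣S∣<k)
... | two , connected =
  subst (2 ≤_) (∣∣-cong R≗) two ,
  λ u w u∈ w∈ → Reach-cong R≗ (connected u w (trans (R≗ u) u∈) (trans (R≗ w) w∈))
  where
  R≗ : remove D' X ≗ remove D' S
  R≗ i = cong (λ b → vert D' i ∧ not b) (X≗S i)

-- Induced sub-digraphs

module _ (D : Digraph m) where

  induced : Subset m → SubDigraph D
  induced W = record
    { vert    = W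
    ; arc'    = λ u w → W u ∧ (W ∩ arc D u) w
    ; arc'⊆   = λ u w e → ∧-conicalʳ (W w) _ (∧-conicalʳ (W u) _ e)
    ; arc'-vs = λ u w e → ∧-conicalˡ (W u) _ e , ∧-conicalˡ (W w) _ (∧-conicalʳ (W u) _ e)
    }

  outdegIn : Subset m → Fin m → ℕ
  outdegIn W v = ∣ W ∩ arc D v ∣

  outdeg-induced : v ∈ W → outdeg' (induced W) v ≡ outdegIn W v
  outdeg-induced v∈W rewrite v∈W = refl

  induced-arc : v ∈ W → w ∈ W ∩ arc D v → arc' (induced W) v w ≡ true
  induced-arc v∈W v→w rewrite v∈W = v→w

  outdegIn<∣W∣ : v ∈ W → outdegIn W v < ∣ W ∣
  outdegIn<∣W∣ {v = v} {W = W} v∈W =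
    p⊊q⇒∣p∣<∣q∣ {P = W ∩ arc D v} {Q = W} (λ i e → proj₁ (x∈p∩q⁻ W (arc D v) e)) v∈W v∉N
    where
    v∉N : v ∉ W ∩ arc D v
    v∉N rewrite irrefl D v = ∧-zeroʳ (W v)

  closed⇒out-arcs : ∀ {C} → C ⊆ W → Closed (induced W) (W ─ X) C →
                    v ∈ C → W ∩ arc D v ⊆ (C ∩ arc D v) ∪ X
  closed⇒out-arcs {W = W} {X = X} {v = v} {C} C⊆W closed v∈C y y∈N with ∈⊎∉ X y
  ... | inj₁ y∈X = x∈p∪q⁺ (C ∩ arc D v) X (inj₂ y∈X)
  ... | inj₂ y∉X = x∈p∪q⁺ (C ∩ arc D v) X (inj₁ (x∈p∩q⁺ C (arc D v) y∈C v→y))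
    where
    y∈W : y ∈ W
    y∈W = proj₁ (x∈p∩q⁻ W (arc D v) y∈N)
    v→y : y ∈ arc D v
    v→y = proj₂ (x∈p∩q⁻ W (arc D v) y∈N)
    y∈C : y ∈ C
    y∈C = closed v y v∈C (x∈p─q⁺ W X y∈W y∉X) (inj₁ (induced-arc {W = W} (C⊆W v v∈C) y∈N))

  record Fragment (W X : Subset m) : Set where
    field
      C           : Subset m
      C-nonempty  : ∃ (_∈ C)
      C⊆W         : C ⊆ W
      ∣C∣+∣C∣≤∣W∣ : ∣ C ∣ + ∣ C ∣ ≤ ∣ W ∣
      out-arcs    : ∀ v → v ∈ C → W ∩ arc D v ⊆ (C ∩ arc D v) ∪ X

  disconnection⇒fragment : Disconnection (induced W) (W ─ X) → Fragment W X
  disconnection⇒fragment {W = W} {X = X} δ = smaller (≤-total ∣ A ∣ ∣ B ∣)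
    where
    open Disconnection δ
    B : Subset m
    B = (W ─ X) ─ A
    R⊆W : W ─ X ⊆ W
    R⊆W i i∈R = proj₁ (x∈p─q⁻ W X i∈R)
    A⊆W : A ⊆ W
    A⊆W i i∈A = R⊆W i (A⊆R i i∈A)
    B⊆W : B ⊆ W
    B⊆W i i∈B = R⊆W i (proj₁ (x∈p─q⁻ (W ─ X) A i∈B))
    ∣A∣+∣B∣≤∣W∣ : ∣ A ∣ + ∣ B ∣ ≤ ∣ W ∣
    ∣A∣+∣B∣≤∣W∣ = disjoint⇒∣p∣+∣q∣≤∣r∣
      (λ i i∈A i∈B → ∉⇒¬∈ A (proj₂ (x∈p─q⁻ (W ─ X) A i∈B)) i∈A) A⊆W B⊆W
    smaller : ∣ A ∣ ≤ ∣ B ∣ ⊎ ∣ B ∣ ≤ ∣ A ∣ → Fragment W X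
    smaller (inj₁ ∣A∣≤∣B∣) = record
      { C = A ; C-nonempty = a , a∈A ; C⊆W = A⊆W
      ; ∣C∣+∣C∣≤∣W∣ = ≤-trans (+-monoʳ-≤ ∣ A ∣ ∣A∣≤∣B∣) ∣A∣+∣B∣≤∣W∣
      ; out-arcs = λ v → closed⇒out-arcs A⊆W closed }
    smaller (inj₂ ∣B∣≤∣A∣) = record
      { C = B ; C-nonempty = b , b∈R─A ; C⊆W = B⊆W
      ; ∣C∣+∣C∣≤∣W∣ = ≤-trans (+-monoˡ-≤ ∣ B ∣ ∣B∣≤∣A∣) ∣A∣+∣B∣≤∣W∣
      ; out-arcs = λ v → closed⇒out-arcs B⊆W (Closed-─ (induced W) (W ─ X) closed) }

  fragment-outdeg : (F : Fragment W X) → v ∈ Fragment.C F →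
                    outdegIn W v ≤ outdegIn (Fragment.C F) v + ∣ X ∣
  fragment-outdeg {X = X} {v = v} F v∈C =
    p⊆q∪r⇒∣p∣≤∣q∣+∣r∣ {Q = C ∩ arc D v} {R = X} (out-arcs v v∈C)
    where open Fragment F

  module _ (c : ℕ) where

    record Separator (W X : Subset m) : Set where
      field
        ∣X∣≤c         : ∣ X ∣ ≤ c
        tiny⊎fragment : ∣ W ─ X ∣ < 2 ⊎ Fragment W X

    KConnectedAt⊎Separator : ∀ W X → KConnectedAt (suc c) (induced W) X ⊎ Separator W X
    KConnectedAt⊎Separator W X with ∣ X ∣ ≤? c | 2 ≤? ∣ W ─ X ∣
    ... | no ∣X∣≰c | _ = inj₁ λ _ ∣X∣<1+c → contradiction (≤-pred ∣X∣<1+c) ∣X∣≰c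
    ... | yes ∣X∣≤c | no ∣W─X∣≱2 =
      inj₂ record { ∣X∣≤c = ∣X∣≤c ; tiny⊎fragment = inj₁ (≰⇒> ∣W─X∣≱2) }
    ... | yes ∣X∣≤c | yes ∣W─X∣≥2
      with 0<∣p∣⇒∃∈ {P = W ─ X} (≤-trans (s≤s z≤n) ∣W─X∣≥2)
    ...   | u , u∈W─X with connected⊎disconnected (induced W) (W ─ X) u∈W─X
    ...     | inj₁ connected = inj₁ λ _ _ → ∣W─X∣≥2 , connected
    ...     | inj₂ δ =
      inj₂ record { ∣X∣≤c = ∣X∣≤c ; tiny⊎fragment = inj₂ (disconnection⇒fragment δ) }

    tiny⇒outdegIn≤c : ∣ X ∣ ≤ c → ∣ W ─ X ∣ < 2 → v ∈ W → outdegIn W v ≤ c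
    tiny⇒outdegIn≤c {X = X} {W = W} {v = v} ∣X∣≤c ∣W─X∣<2 v∈W = ≤-pred (begin-strict
      outdegIn W v      <⟨ outdegIn<∣W∣ v∈W ⟩
      ∣ W ∣             ≤⟨ p⊆q∪r⇒∣p∣≤∣q∣+∣r∣ {Q = X} {R = W ─ X} W⊆X∪W─X ⟩
      ∣ X ∣ + ∣ W ─ X ∣ ≤⟨ +-mono-≤ ∣X∣≤c (≤-pred ∣W─X∣<2) ⟩
      c + 1             ≡⟨ +-comm c 1 ⟩
      suc c             ∎)
      where
      open ≤-Reasoning
      W⊆X∪W─X : W ⊆ X ∪ (W ─ X)
      W⊆X∪W─X i i∈W with ∈⊎∉ X i
      ... | inj₁ i∈X = x∈p∪q⁺ X (W ─ X) (inj₁ i∈X)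
      ... | inj₂ i∉X = x∈p∪q⁺ X (W ─ X) (inj₂ (x∈p─q⁺ W X i∈W i∉X))

    HighlyConnectedIn : ℕ → Subset m → Set
    HighlyConnectedIn L W = Σ (SubDigraph D) λ D' →
      vert D' ⊆ W × (∀ v → v ∈ vert D' → outdegIn W v ≤ outdeg' D' v + c * L) ×
      KConnected (suc c) D'

    fragment-outdeg> : (F : Fragment W X) → ∣ X ∣ ≤ c →
                       (∀ v → v ∈ W → c * suc L < outdegIn W v) →
                       ∀ v → v ∈ Fragment.C F → c * L < outdegIn (Fragment.C F) v
    fragment-outdeg> {W = W} {X = X} {L = L} F ∣X∣≤c outdeg> v v∈C = +-cancelˡ-< c _ _ (begin-strict
      c + c * L              ≡⟨ *-suc c L ⟨
      c * suc L              <⟨ outdeg> v (C⊆W v v∈C) ⟩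
      outdegIn W v           ≤⟨ fragment-outdeg F v∈C ⟩
      outdegIn C v + ∣ X ∣   ≤⟨ +-monoʳ-≤ (outdegIn C v) ∣X∣≤c ⟩
      outdegIn C v + c       ≡⟨ +-comm (outdegIn C v) c ⟩
      c + outdegIn C v       ∎)
      where
      open ≤-Reasoning
      open Fragment F

    fragment-lift : (F : Fragment W X) → ∣ X ∣ ≤ c →
                    HighlyConnectedIn L (Fragment.C F) → HighlyConnectedIn (suc L) W
    fragment-lift {W = W} {X = X} {L = L} F ∣X∣≤c (D' , D'⊆C , outdeg-bound , κ) =
      D' , (λ v v∈D' → C⊆W v (D'⊆C v v∈D')) , bound , κ
      where
      open Fragment F
      open ≤-Reasoning
      bound : ∀ v → v ∈ vert D' → outdegIn W v ≤ outdeg' D' v + c * suc L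
      bound v v∈D' = begin
        outdegIn W v                 ≤⟨ fragment-outdeg F (D'⊆C v v∈D') ⟩
        outdegIn C v + ∣ X ∣         ≤⟨ +-mono-≤ (outdeg-bound v v∈D') ∣X∣≤c ⟩
        (outdeg' D' v + c * L) + c   ≡⟨ +-assoc (outdeg' D' v) (c * L) c ⟩
        outdeg' D' v + (c * L + c)   ≡⟨ cong (outdeg' D' v +_) (+-comm (c * L) c) ⟩
        outdeg' D' v + (c + c * L)   ≡⟨ cong (outdeg' D' v +_) (*-suc c L) ⟨
        outdeg' D' v + c * suc L     ∎

    highly-connected-subgraph : ∀ L W → ∃ (_∈ W) → ⌈log₂ ∣ W ∣ ⌉ ≤ L →
                                (∀ v → v ∈ W → c * L < outdegIn W v) → HighlyConnectedIn L W
    highly-connected-subgraph zero W (v , v∈W) log≤0 outdeg> =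
      contradiction (outdeg> v v∈W) (≤⇒≯ outdeg≤c*0)
      where
      outdeg≤c*0 : outdegIn W v ≤ c * 0
      outdeg≤c*0 = subst (outdegIn W v ≤_) (sym (*-zeroʳ c))
        (≤-pred (≤-trans (outdegIn<∣W∣ v∈W) (⌈log₂n⌉≤0⇒n≤1 log≤0)))
    highly-connected-subgraph (suc L) W (v , v∈W) log≤ outdeg>
      with all⊎counterexample KConnectedAt-cong (KConnectedAt⊎Separator W)
    ... | inj₁ κ = induced W , (λ _ u∈W → u∈W) , bound , κ
      where
      bound : ∀ u → u ∈ W → outdegIn W u ≤ outdeg' (induced W) u + c * suc L
      bound u u∈W = ≤-trans (≤-reflexive (sym (outdeg-induced u∈W))) (m≤m+n _ _)
    ... | inj₂ (X , record { ∣X∣≤c = ∣X∣≤c ; tiny⊎fragment = inj₁ tiny }) =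
      contradiction (outdeg> v v∈W)
        (≤⇒≯ (≤-trans (tiny⇒outdegIn≤c ∣X∣≤c tiny v∈W) (m≤m*n c (suc L))))
    ... | inj₂ (X , record { ∣X∣≤c = ∣X∣≤c ; tiny⊎fragment = inj₂ F }) =
      fragment-lift F ∣X∣≤c
        (highly-connected-subgraph L (Fragment.C F) (Fragment.C-nonempty F)
          (⌈log₂⌉-half {a = ∣ Fragment.C F ∣} (Fragment.∣C∣+∣C∣≤∣W∣ F) log≤)
          (fragment-outdeg> F ∣X∣≤c outdeg>))

-- outdegIn D ⊤ v computes to outdeg D v.
lemma7 : (k n m : ℕ) → 1 ≤ k → 1 ≤ n → 1 ≤ m → m ≤ n →
    (D : Digraph m) →
    (∀ v → (k ∸ 1) * ⌈log₂ n ⌉ < outdeg D v) →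
    Σ (SubDigraph D) λ D' →
      (∀ v → vert D' v ≡ true → outdeg D v ≤ outdeg' D' v + (k ∸ 1) * ⌈log₂ n ⌉)
      × KConnected k D'
lemma7 (suc c) n (suc m) _ _ _ m+1≤n D outdeg>
  with highly-connected-subgraph D c ⌈log₂ n ⌉ ⊤ (zero , refl) log∣⊤∣≤log-n (λ v _ → outdeg> v)
  where
  log∣⊤∣≤log-n : ⌈log₂ ∣ ⊤ {suc m} ∣ ⌉ ≤ ⌈log₂ n ⌉
  log∣⊤∣≤log-n = ≤-trans (≤-reflexive (cong ⌈log₂_⌉ (∣⊤∣≡m {suc m}))) (⌈log₂⌉-mono-≤ m+1≤n)
... | D' , _ , outdeg-bound , κ = D' , outdeg-bound , κ
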